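{- Let $(D,r)$ be a rooted digraph, let $v\in V(D)$, and let $D'$ be obtained from $D$ by duplicating $v$. Then $|\mathrm{sp}(D')|\ge|\mathrm{sp}(D)|$, and if $D'$ has an outbranching rooted at $r$ then $\mathrm{maxleaf}(D)\ge\mathrm{maxleaf}(D')-1$.
   Context: A rooted digraph $(D,r)$ is a finite digraph without loops or parallel arcs with a root $r$ of in-degree $0$. Duplicating $v$ produces $D'$ with $V(D')=V(D)\cup\{v'\}$ ($v'$ a new vertex) and $E(D')=E(D)\cup\{(x,v'):(x,v)\in E(D)\}\cup\{(v',x):(v,x)\in E(D)\}$. A vertex $w$ is special if its in-degree is at least $3$ or there is an arc $(u,w)$ with $(w,u)$ not an arc; $\mathrm{sp}(\cdot)$ is the set of special vertices. An outbranching rooted at $r$ is a spanning subgraph whose underlying undirected graph is a tree with arcs oriented away from $r$; leaves are vertices of out-degree $0$ in it; $\mathrm{maxleaf}$ is the maximum number of leaves of such an outbranching. -}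

module Defs where

open import Data.Nat using (ℕ; zero; suc; _+_; _∸_; _≤_; _≤ᵇ_)
open import Data.Fin using (Fin; zero; suc)
open import Data.Bool using (Bool; true; false; _∧_; _∨_; not; if_then_else_)
open import Relation.Binary.PropositionalEquality using (_≡_)

-- A digraph on vertex set Fin n, given by its arc relation.
-- (A Bool-valued relation automatically excludes parallel arcs.)
Arcs : ℕ → Set
Arcs n = Fin n → Fin n → Bool

count : ∀ {n} → (Fin n → Bool) → ℕ
count {zero}  p = 0
count {suc n} p = (if p zero then 1 else 0) + count (λ i → p (suc i))

anyV : ∀ {n} → (Fin n → Bool) → Bool
anyV {zero}  p = false
anyV {suc n} p = p zero ∨ anyV (λ i → p (suc i))

record IsRootedDigraph {n : ℕ} (E : Arcs n) (r : Fin n) : Set where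
  field
    noLoop   : ∀ x → E x x ≡ false
    rootIn0  : ∀ x → E x r ≡ false

inDeg : ∀ {n} → Arcs n → Fin n → ℕ
inDeg E w = count (λ u → E u w)

outDeg : ∀ {n} → Arcs n → Fin n → ℕ
outDeg E w = count (λ u → E w u)

special : ∀ {n} → Arcs n → Fin n → Bool
special E w = (3 ≤ᵇ inDeg E w) ∨ anyV (λ u → E u w ∧ not (E w u))

spCount : ∀ {n} → Arcs n → ℕ
spCount E = count (special E)

-- Duplicating v.  The new vertex v' is  zero : Fin (suc n);
-- an old vertex x of D is  suc x  in D'.
duplicate : ∀ {n} → Arcs n → Fin n → Arcs (suc n)
duplicate E v zero    zero    = false
duplicate E v zero    (suc y) = E v y
duplicate E v (suc x) zero    = E x v
duplicate E v (suc x) (suc y) = E x y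

sumV : ∀ {n} → (Fin n → ℕ) → ℕ
sumV {zero}  f = 0
sumV {suc n} f = f zero + sumV (λ i → f (suc i))

arcCount : ∀ {n} → Arcs n → ℕ
arcCount B = sumV (outDeg B)

data Reach {n : ℕ} (B : Arcs n) (r : Fin n) : Fin n → Set where
  here : Reach B r r
  step : ∀ {x y} → Reach B r x → B x y ≡ true → Reach B r y

-- An outbranching of (E, r): a spanning subgraph B ⊆ E whose underlying
-- undirected graph is a tree with arcs oriented away from r.  Encoded as:
-- every vertex is reachable from r along arcs of B (so the underlying
-- graph is connected and arcs point away from r), and B has exactly
-- n - 1 arcs (so the connected underlying graph is a tree).
record IsOutbranching {n : ℕ} (E : Arcs n) (r : Fin n) (B : Arcs n) : Set where
  field
    sub      : ∀ x y → B x y ≡ true → E x y ≡ true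
    reach    : ∀ x → Reach B r x
    nArcs    : arcCount B ≡ n ∸ 1

leaves : ∀ {n} → Arcs n → ℕ
leaves B = count (λ x → outDeg B x ≤ᵇ 0)

{-# OPTIONS --safe #-}
-- Duplication keeps the arcs among the old vertices and only adds arcs at the copy v′, so an
-- old vertex keeps its in-arcs and their asymmetry: special vertices of D stay special in D′.
-- For the leaves, take an outbranching B′ of D′ and a path in it from the root to v: one of the
-- two copies of v is entered first, so it is reached without entering the other.  Deleting the
-- in-arc of that other copy and then identifying the two copies gives a subgraph of D in which
-- every vertex is still reachable from r.  It has at least n - 1 arcs, since every vertex but r
-- has an in-arc, and fewer than the n arcs of B′, so it is an outbranching.  A vertex other than
-- v is a leaf if its copy in B′ was one, and v is a leaf if both of its copies were, so at most
-- one leaf is lost.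
module Submission where

open import Defs
open import Data.Nat using (ℕ; zero; suc; _+_; _≤_; _<_; _∸_; _≤ᵇ_; z≤n; s≤s)
open import Data.Fin using (Fin; zero; suc; _≟_)
open import Data.Product using (Σ; _×_; _,_; proj₁; ∃)

open import Data.Bool using (Bool; true; false; not; _∧_; _∨_; if_then_else_)
open import Data.Bool.Properties using (T-≡; ∨-zeroʳ)
open import Data.Empty using (⊥-elim)
open import Data.Fin.Properties using (suc-injective)
open import Data.Nat.Properties
  using ( ≤-refl; ≤-reflexive; ≤-trans; ≤-antisym; n≮0; n≤0⇒n≡0; m≤n+m; +-comm; +-identityʳ
        ; +-mono-≤; +-monoʳ-≤; +-mono-≤-<; +-mono-<-≤; ∸-monoˡ-≤; ≤ᵇ⇒≤; ≤⇒≤ᵇ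
        ; +-0-commutativeMonoid; +-commutativeSemigroup; module ≤-Reasoning )
open import Data.Sum using (_⊎_; inj₁; inj₂; [_,_]′)
open import Function using (id; _∘_; Equivalence)
open import Relation.Nullary.Decidable using (yes; no; does; dec-true; dec-false)
open import Relation.Binary.PropositionalEquality

open import Algebra.Properties.CommutativeMonoid.Sum +-0-commutativeMonoid
  using (sum; sum-cong-≗; sum-replicate-zero; ∑-distrib-+; ∑-comm)
open import Algebra.Properties.CommutativeSemigroup +-commutativeSemigroup
  using (interchange)

private
  variable
    m n : ℕ

indicator : Bool → ℕ
indicator b = if b then 1 else 0

_⊆_ : (Fin n → Bool) → (Fin n → Bool) → Set
p ⊆ q = ∀ i → p i ≡ true → q i ≡ true

_⊆ᵃ_ : Arcs n → Arcs n → Set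
B ⊆ᵃ C = ∀ x y → B x y ≡ true → C x y ≡ true

∨-cases : ∀ a {b} → a ∨ b ≡ true → a ≡ true ⊎ b ≡ true
∨-cases true  _ = inj₁ refl
∨-cases false e = inj₂ e

∨-introˡ : ∀ {a b} → a ≡ true → a ∨ b ≡ true
∨-introˡ refl = refl

∨-introʳ : ∀ a {b} → b ≡ true → a ∨ b ≡ true
∨-introʳ a refl = ∨-zeroʳ a

indicator-mono : ∀ {a b} → (a ≡ true → b ≡ true) → indicator a ≤ indicator b
indicator-mono {false} _ = z≤n
indicator-mono {true} a⇒b rewrite a⇒b refl = ≤-refl

indicator-∨ : ∀ a b → indicator (a ∨ b) ≤ indicator a + indicator b
indicator-∨ false b = ≤-refl
indicator-∨ true  b = s≤s z≤n

count-mono : {p q : Fin n → Bool} → p ⊆ q → count p ≤ count q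
count-mono {zero}  _   = z≤n
count-mono {suc n} p⊆q = +-mono-≤ (indicator-mono (p⊆q zero)) (count-mono (p⊆q ∘ suc))

count-mono-< : {p q : Fin n → Bool} → p ⊆ q → ∀ i → p i ≡ false → q i ≡ true → count p < count q
count-mono-< p⊆q zero    pᵢ qᵢ rewrite pᵢ | qᵢ = s≤s (count-mono (p⊆q ∘ suc))
count-mono-< p⊆q (suc i) pᵢ qᵢ =
  +-mono-≤-< (indicator-mono (p⊆q zero)) (count-mono-< (p⊆q ∘ suc) i pᵢ qᵢ)

count-∨ : (p q : Fin n → Bool) → count (λ i → p i ∨ q i) ≤ count p + count q
count-∨ {zero}  p q = z≤n
count-∨ {suc n} p q = ≤-trans
  (+-mono-≤ (indicator-∨ (p zero) (q zero)) (count-∨ (p ∘ suc) (q ∘ suc)))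
  (≤-reflexive (interchange (indicator (p zero)) _ _ _))

count-none : {p : Fin n → Bool} → (∀ i → p i ≡ false) → count p ≡ 0
count-none {zero}  _    = refl
count-none {suc n} none rewrite none zero = count-none (none ∘ suc)

count-pos : (p : Fin n → Bool) (i : Fin n) → p i ≡ true → 0 < count p
count-pos p zero    pᵢ rewrite pᵢ = s≤s z≤n
count-pos p (suc i) pᵢ = ≤-trans (count-pos (p ∘ suc) i pᵢ) (m≤n+m _ _)

count≡0⇒none : (p : Fin n → Bool) → count p ≡ 0 → ∀ i → p i ≡ false
count≡0⇒none p c≡0 i with p i in pᵢ
... | false = refl
... | true  = ⊥-elim (n≮0 (subst (0 <_) c≡0 (count-pos p i pᵢ)))

count-≟ : (v : Fin n) → count (λ y → does (y ≟ v)) ≡ 1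
count-≟ {suc n} zero = cong suc (count-none {n} (λ _ → refl))
count-≟ (suc v)      = count-≟ v

count-∧ : (b : Bool) (p : Fin n → Bool) → count (λ i → b ∧ p i) ≤ (if b then count p else 0)
count-∧ {n} false p = ≤-reflexive (count-none {n} (λ _ → refl))
count-∧     true  p = ≤-refl

count≡sumV : (p : Fin n → Bool) → count p ≡ sumV (indicator ∘ p)
count≡sumV {zero}  p = refl
count≡sumV {suc n} p = cong (indicator (p zero) +_) (count≡sumV (p ∘ suc))

sumV≡sum : (f : Fin n → ℕ) → sumV f ≡ sum f
sumV≡sum {zero}  f = refl
sumV≡sum {suc n} f = cong (f zero +_) (sumV≡sum (f ∘ suc))

sumV-cong : {f g : Fin n → ℕ} → (∀ i → f i ≡ g i) → sumV f ≡ sumV g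
sumV-cong {zero}  _   = refl
sumV-cong {suc n} f≗g = cong₂ _+_ (f≗g zero) (sumV-cong (f≗g ∘ suc))

sumV-+ : (f g : Fin n → ℕ) → sumV (λ i → f i + g i) ≡ sumV f + sumV g
sumV-+ f g = begin
  sumV (λ i → f i + g i)  ≡⟨ sumV≡sum (λ i → f i + g i) ⟩
  sum (λ i → f i + g i)   ≡⟨ ∑-distrib-+ f g ⟩
  sum f + sum g           ≡⟨ cong₂ _+_ (sumV≡sum f) (sumV≡sum g) ⟨
  sumV f + sumV g         ∎
  where open ≡-Reasoning

sumV-comm : (f : Fin m → Fin n → ℕ) →
            sumV (λ x → sumV (f x)) ≡ sumV (λ y → sumV (λ x → f x y))
sumV-comm f = begin
  sumV (λ x → sumV (f x))         ≡⟨ sumV≡sum (λ x → sumV (f x)) ⟩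
  sum (λ x → sumV (f x))          ≡⟨ sum-cong-≗ (sumV≡sum ∘ f) ⟩
  sum (λ x → sum (f x))           ≡⟨ ∑-comm f ⟩
  sum (λ y → sum (λ x → f x y))   ≡⟨ sum-cong-≗ (λ y → sumV≡sum (λ x → f x y)) ⟨
  sum (λ y → sumV (λ x → f x y))  ≡⟨ sumV≡sum (λ y → sumV (λ x → f x y)) ⟨
  sumV (λ y → sumV (λ x → f x y)) ∎
  where open ≡-Reasoning

sumV-≟ : (v : Fin n) (k : ℕ) → sumV (λ x → if does (x ≟ v) then k else 0) ≡ k
sumV-≟ {suc n} zero k = begin
  k + sumV {n} (λ _ → 0)  ≡⟨ cong (k +_) (trans (sumV≡sum {n} (λ _ → 0)) (sum-replicate-zero n)) ⟩
  k + 0                   ≡⟨ +-identityʳ k ⟩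
  k                       ∎
  where open ≡-Reasoning
sumV-≟ (suc v) k = sumV-≟ v k

sumV-mono : {f g : Fin n → ℕ} → (∀ i → f i ≤ g i) → sumV f ≤ sumV g
sumV-mono {zero}  _   = z≤n
sumV-mono {suc n} f≤g = +-mono-≤ (f≤g zero) (sumV-mono (f≤g ∘ suc))

sumV-mono-< : {f g : Fin n → ℕ} → (∀ i → f i ≤ g i) → ∀ i → f i < g i → sumV f < sumV g
sumV-mono-< f≤g zero    fᵢ<gᵢ = +-mono-<-≤ fᵢ<gᵢ (sumV-mono (f≤g ∘ suc))
sumV-mono-< f≤g (suc i) fᵢ<gᵢ = +-mono-≤-< (f≤g zero) (sumV-mono-< (f≤g ∘ suc) i fᵢ<gᵢ)

sumV-pos : {f : Fin n → ℕ} → (∀ i → 0 < f i) → n ≤ sumV f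
sumV-pos {zero}  _   = z≤n
sumV-pos {suc n} pos = +-mono-≤ (pos zero) (sumV-pos (pos ∘ suc))

sumV-pos-off : {f : Fin n → ℕ} (r : Fin n) → (∀ i → i ≢ r → 0 < f i) → n ∸ 1 ≤ sumV f
sumV-pos-off zero pos = ≤-trans (sumV-pos (λ i → pos (suc i) λ ())) (m≤n+m _ _)
sumV-pos-off {suc (suc n)} (suc r) pos =
  +-mono-≤ (pos zero λ ()) (sumV-pos-off r (λ i i≢r → pos (suc i) (i≢r ∘ suc-injective)))

arcCount≡sumV-inDeg : (B : Arcs n) → arcCount B ≡ sumV (inDeg B)
arcCount≡sumV-inDeg B = begin
  sumV (λ x → count (B x))                         ≡⟨ sumV-cong (count≡sumV ∘ B) ⟩
  sumV (λ x → sumV (λ y → indicator (B x y)))      ≡⟨ sumV-comm (λ x y → indicator (B x y)) ⟩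
  sumV (λ y → sumV (λ x → indicator (B x y)))      ≡⟨ sumV-cong (λ y → count≡sumV (λ x → B x y)) ⟨
  sumV (inDeg B)                                   ∎
  where open ≡-Reasoning

arcCount-mono-< : {B C : Arcs n} → C ⊆ᵃ B → ∀ x y → C x y ≡ false → B x y ≡ true →
                  arcCount C < arcCount B
arcCount-mono-< C⊆B x y Cxy Bxy =
  sumV-mono-< (λ x → count-mono (C⊆B x)) x (count-mono-< (C⊆B x) y Cxy Bxy)

reach-map-via : {B : Arcs m} {C : Arcs n} {ρ z : Fin m} {w : Fin n} (f : Fin m → Fin n) →
                Reach C (f ρ) w → (∀ {x y} → B x y ≡ true → f y ≡ w ⊎ C (f x) (f y) ≡ true) →
                Reach B ρ z → Reach C (f ρ) (f z)
reach-map-via f ρ⇝w arc here = here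
reach-map-via {C = C} f ρ⇝w arc (step ρ⇝x e) with arc e
... | inj₁ fz≡w  = subst (Reach C _) (sym fz≡w) ρ⇝w
... | inj₂ e′    = step (reach-map-via f ρ⇝w arc ρ⇝x) e′

reach-map : {B : Arcs m} {C : Arcs n} {ρ z : Fin m} (f : Fin m → Fin n) →
            (∀ {x y} → B x y ≡ true → C (f x) (f y) ≡ true) → Reach B ρ z → Reach C (f ρ) (f z)
reach-map f hom = reach-map-via f here (inj₂ ∘ hom)

reach-parent : {B : Arcs n} {ρ z : Fin n} → Reach B ρ z → z ≢ ρ → ∃ λ x → B x z ≡ true
reach-parent here           z≢ρ = ⊥-elim (z≢ρ refl)
reach-parent (step {x} _ e) _   = x , e

spanning⇒arcCount≥ : {B : Arcs n} {r : Fin n} → (∀ z → Reach B r z) → n ∸ 1 ≤ arcCount B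
spanning⇒arcCount≥ {B = B} {r} reach = subst (_ ≤_) (sym (arcCount≡sumV-inDeg B))
  (sumV-pos-off r λ z z≢r → let (x , e) = reach-parent (reach z) z≢r in count-pos _ x e)

removeInArcs : Fin n → Arcs n → Arcs n
removeInArcs t B x y = not (does (y ≟ t)) ∧ B x y

removeInArcs-⊆ : (t : Fin n) (B : Arcs n) → removeInArcs t B ⊆ᵃ B
removeInArcs-⊆ t B x y e with y ≟ t
... | no _ = e

removeInArcs-keeps : (B : Arcs n) {t x y : Fin n} → y ≢ t → B x y ≡ true →
                     removeInArcs t B x y ≡ true
removeInArcs-keeps B {t} {y = y} y≢t e rewrite dec-false (y ≟ t) y≢t = e

removeInArcs-removes : (t : Fin n) (B : Arcs n) (x : Fin n) → removeInArcs t B x t ≡ false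
removeInArcs-removes t B x rewrite dec-true (t ≟ t) refl = refl

-- Whichever of s and t a path enters first is reached without entering the other.
reach-avoiding-one : {B : Arcs n} {ρ s t : Fin n} → s ≢ t → Reach B ρ t →
                     Reach (removeInArcs s B) ρ t ⊎ Reach (removeInArcs t B) ρ s
reach-avoiding-one {_} {B} {ρ} {s} {t} s≢t ρ⇝t = [ inj₁ ∘ proj₁ , id ]′ (go ρ⇝t)
  where
  go : ∀ {z} → Reach B ρ z →
       (Reach (removeInArcs s B) ρ z × Reach (removeInArcs t B) ρ z)
       ⊎ (Reach (removeInArcs s B) ρ t ⊎ Reach (removeInArcs t B) ρ s)
  go here = inj₁ (here , here)
  go (step {y = z} ρ⇝x e) with go ρ⇝x
  ... | inj₂ found = inj₂ found
  ... | inj₁ (ρ⇝ˢx , ρ⇝ᵗx) with z ≟ s | z ≟ t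
  ...   | yes refl | _        = inj₂ (inj₂ (step ρ⇝ᵗx (removeInArcs-keeps B s≢t e)))
  ...   | no z≢s   | yes refl = inj₂ (inj₁ (step ρ⇝ˢx (removeInArcs-keeps B z≢s e)))
  ...   | no z≢s   | no z≢t   =
    inj₁ ( step ρ⇝ˢx (removeInArcs-keeps B z≢s e)
         , step ρ⇝ᵗx (removeInArcs-keeps B z≢t e))

≤ᵇ0⇒≡0 : ∀ {k} → (k ≤ᵇ 0) ≡ true → k ≡ 0
≤ᵇ0⇒≡0 {zero} _ = refl

≡0⇒≤ᵇ0 : ∀ {k} → k ≡ 0 → (k ≤ᵇ 0) ≡ true
≡0⇒≤ᵇ0 refl = refl

isLeaf : Arcs n → Fin n → Bool
isLeaf B x = outDeg B x ≤ᵇ 0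

isLeaf⇒noOut : (B : Arcs n) (x : Fin n) → isLeaf B x ≡ true → ∀ y → B x y ≡ false
isLeaf⇒noOut B x leaf = count≡0⇒none (B x) (≤ᵇ0⇒≡0 leaf)

noOut⇒isLeaf : (B : Arcs n) (x : Fin n) → (∀ y → B x y ≡ false) → isLeaf B x ≡ true
noOut⇒isLeaf B x noOut = ≡0⇒≤ᵇ0 (count-none noOut)

leaves-antitone : {B C : Arcs n} → C ⊆ᵃ B → leaves B ≤ leaves C
leaves-antitone C⊆B = count-mono λ x leaf →
  ≡0⇒≤ᵇ0 (n≤0⇒n≡0 (≤-trans (count-mono (C⊆B x)) (≤-reflexive (≤ᵇ0⇒≡0 leaf))))

≤ᵇ-+ˡ : ∀ k {m l} → (m ≤ᵇ l) ≡ true → (m ≤ᵇ k + l) ≡ true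
≤ᵇ-+ˡ k {m} {l} m≤ᵇl = Equivalence.to T-≡
  (≤⇒≤ᵇ (≤-trans (≤ᵇ⇒≤ m l (Equivalence.from T-≡ m≤ᵇl)) (m≤n+m l k)))

special-duplicate : (E : Arcs n) (v x : Fin n) →
                    special E x ≡ true → special (duplicate E v) (suc x) ≡ true
special-duplicate E v x sp with ∨-cases (3 ≤ᵇ inDeg E x) sp
... | inj₁ many       = ∨-introˡ (≤ᵇ-+ˡ (indicator (E v x)) many)
... | inj₂ asymmetric =
  ∨-introʳ (3 ≤ᵇ inDeg (duplicate E v) (suc x)) (∨-introʳ (E v x ∧ not (E x v)) asymmetric)

spCount-duplicate : (E : Arcs n) (v : Fin n) → spCount E ≤ spCount (duplicate E v)
spCount-duplicate E v = ≤-trans (count-mono (special-duplicate E v)) (m≤n+m _ _)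

collapse : Fin n → Fin (suc n) → Fin n
collapse v zero    = v
collapse v (suc x) = x

duplicate⇒collapse : (E : Arcs n) (v : Fin n) (x y : Fin (suc n)) →
                     duplicate E v x y ≡ true → E (collapse v x) (collapse v y) ≡ true
duplicate⇒collapse E v zero    zero    ()
duplicate⇒collapse E v zero    (suc y) e = e
duplicate⇒collapse E v (suc x) zero    e = e
duplicate⇒collapse E v (suc x) (suc y) e = e

count-collapse : (v : Fin n) (P : Fin (suc n) → Bool) (Q : Fin n → Bool) →
                 (∀ x → P (suc x) ≡ true → (x ≡ v → P zero ≡ true) → Q x ≡ true) →
                 count P ∸ 1 ≤ count Q
count-collapse v P Q PQ with P zero
... | true  = count-mono (λ x Pₓ → PQ x Pₓ (λ _ → refl))
... | false = ∸-monoˡ-≤ 1 (begin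
  count (P ∘ suc)                       ≤⟨ count-mono P⊆v∨Q ⟩
  count (λ x → does (x ≟ v) ∨ Q x)      ≤⟨ count-∨ (λ x → does (x ≟ v)) Q ⟩
  count (λ x → does (x ≟ v)) + count Q  ≡⟨ cong (_+ count Q) (count-≟ v) ⟩
  suc (count Q)                         ∎)
  where
  open ≤-Reasoning
  P⊆v∨Q : (P ∘ suc) ⊆ (λ x → does (x ≟ v) ∨ Q x)
  P⊆v∨Q x Pₓ with x ≟ v
  ... | yes _  = refl
  ... | no x≢v = PQ x Pₓ (⊥-elim ∘ x≢v)

-- collapseArcs v C is the image of C under collapse v; collapseTargets v C x is the image of
-- the out-neighbourhood of x.
collapseTargets : Fin n → Arcs (suc n) → Fin (suc n) → Fin n → Bool
collapseTargets v C x y = C x (suc y) ∨ (C x zero ∧ does (y ≟ v))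

collapseArcs : Fin n → Arcs (suc n) → Arcs n
collapseArcs v C x y = collapseTargets v C (suc x) y ∨ (does (x ≟ v) ∧ collapseTargets v C zero y)

module _ (v : Fin n) (C : Arcs (suc n)) where

  collapseTargets-preimage : ∀ {x y} → collapseTargets v C x y ≡ true →
                             ∃ λ y′ → collapse v y′ ≡ y × C x y′ ≡ true
  collapseTargets-preimage {x} {y} e with ∨-cases (C x (suc y)) e
  ... | inj₁ Cxy = suc y , refl , Cxy
  ... | inj₂ Cx0∧y≡v with C x zero in Cx0 | y ≟ v
  ...   | true | yes refl = zero , refl , Cx0

  collapseArcs-preimage : ∀ {x y} → collapseArcs v C x y ≡ true →
                          ∃ λ x′ → ∃ λ y′ → collapse v x′ ≡ x × collapse v y′ ≡ y × C x′ y′ ≡ true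
  collapseArcs-preimage {x} e with ∨-cases (collapseTargets v C (suc x) _) e
  ... | inj₁ t = let y′ , p , c = collapseTargets-preimage t in suc x , y′ , refl , p , c
  ... | inj₂ d with x ≟ v
  ...   | yes refl = let y′ , p , c = collapseTargets-preimage d in zero , y′ , refl , p , c

  collapseArcs-⊆ : {E : Arcs n} → C ⊆ᵃ duplicate E v → collapseArcs v C ⊆ᵃ E
  collapseArcs-⊆ {E} C⊆D x y e with collapseArcs-preimage e
  ... | x′ , y′ , refl , refl , c = duplicate⇒collapse E v x′ y′ (C⊆D x′ y′ c)

  collapseArcs-hom : {E : Arcs n} → C ⊆ᵃ duplicate E v → ∀ {x y} → C x y ≡ true →
                     collapseArcs v C (collapse v x) (collapse v y) ≡ true
  collapseArcs-hom C⊆D {zero}  {zero}  c with () ← C⊆D zero zero c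
  collapseArcs-hom C⊆D {zero}  {suc y} c rewrite dec-true (v ≟ v) refl | c =
    ∨-zeroʳ (collapseTargets v C (suc v) y)
  collapseArcs-hom C⊆D {suc x} {zero}  c rewrite c | dec-true (v ≟ v) refl =
    ∨-introˡ (∨-zeroʳ (C (suc x) (suc v)))
  collapseArcs-hom C⊆D {suc x} {suc y} c rewrite c = refl

  collapseArcs-noOut : ∀ {x} → (∀ y → C (suc x) y ≡ false) → (x ≡ v → ∀ y → C zero y ≡ false) →
                       ∀ y → collapseArcs v C x y ≡ false
  collapseArcs-noOut {x} noOutˣ noOut⁰ y with x ≟ v
  ... | no _     rewrite noOutˣ (suc y) | noOutˣ zero = refl
  ... | yes refl rewrite noOutˣ (suc y) | noOutˣ zero | noOut⁰ refl (suc y) | noOut⁰ refl zero =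
    refl

  count-collapseTargets : ∀ x → count (collapseTargets v C x) ≤ outDeg C x
  count-collapseTargets x = begin
    count (collapseTargets v C x)
      ≤⟨ count-∨ (C x ∘ suc) (λ y → C x zero ∧ does (y ≟ v)) ⟩
    count (C x ∘ suc) + count (λ y → C x zero ∧ does (y ≟ v))
      ≤⟨ +-monoʳ-≤ _ (count-∧ (C x zero) (λ y → does (y ≟ v))) ⟩
    count (C x ∘ suc) + (if C x zero then count (λ y → does (y ≟ v)) else 0)
      ≡⟨ cong (λ k → count (C x ∘ suc) + (if C x zero then k else 0)) (count-≟ v) ⟩
    count (C x ∘ suc) + indicator (C x zero)
      ≡⟨ +-comm (count (C x ∘ suc)) _ ⟩
    outDeg C x ∎
    where open ≤-Reasoning

  arcCount-collapseArcs : arcCount (collapseArcs v C) ≤ arcCount C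
  arcCount-collapseArcs = begin
    sumV (outDeg (collapseArcs v C))             ≤⟨ sumV-mono outDeg-collapseArcs ⟩
    sumV (λ x → outDeg C (suc x) + fromCopy x)   ≡⟨ sumV-+ (outDeg C ∘ suc) fromCopy ⟩
    sumV (outDeg C ∘ suc) + sumV fromCopy        ≡⟨ cong (sumV (outDeg C ∘ suc) +_) (sumV-≟ v _) ⟩
    sumV (outDeg C ∘ suc) + count (collapseTargets v C zero)
                                                 ≤⟨ +-monoʳ-≤ _ (count-collapseTargets zero) ⟩
    sumV (outDeg C ∘ suc) + outDeg C zero        ≡⟨ +-comm (sumV (outDeg C ∘ suc)) _ ⟩
    arcCount C                                   ∎
    where
    open ≤-Reasoning
    fromCopy : Fin n → ℕ
    fromCopy x = if does (x ≟ v) then count (collapseTargets v C zero) else 0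
    outDeg-collapseArcs : ∀ x → outDeg (collapseArcs v C) x ≤ outDeg C (suc x) + fromCopy x
    outDeg-collapseArcs x = ≤-trans (count-∨ (collapseTargets v C (suc x)) _)
      (+-mono-≤ (count-collapseTargets (suc x))
                (count-∧ (does (x ≟ v)) (collapseTargets v C zero)))

  leaves-collapseArcs : leaves C ∸ 1 ≤ leaves (collapseArcs v C)
  leaves-collapseArcs = count-collapse v (isLeaf C) (isLeaf (collapseArcs v C)) λ x leafˣ leaf⁰ →
    noOut⇒isLeaf (collapseArcs v C) x
      (collapseArcs-noOut (isLeaf⇒noOut C (suc x) leafˣ) (isLeaf⇒noOut C zero ∘ leaf⁰))

module _ {E : Arcs n} {r v : Fin n} {B′ : Arcs (suc n)}
         (ob : IsOutbranching (duplicate E v) (suc r) B′) where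
  open IsOutbranching ob

  collapse-isOutbranching : ∀ {s t} → collapse v s ≡ v → collapse v t ≡ v → t ≢ suc r →
    Reach (removeInArcs t B′) (suc r) s → IsOutbranching E r (collapseArcs v (removeInArcs t B′))
  collapse-isOutbranching {s} {t} s↦v t↦v t≢root root⇝s = record
    { sub   = collapseArcs-⊆ v C C⊆D
    ; reach = reachB
    ; nArcs = ≤-antisym (∸-monoˡ-≤ 1 arcCount<n) (spanning⇒arcCount≥ reachB)
    }
    where
    C = removeInArcs t B′
    B = collapseArcs v C

    C⊆D : C ⊆ᵃ duplicate E v
    C⊆D x y = sub x y ∘ removeInArcs-⊆ t B′ x y

    r⇝v : Reach B r v
    r⇝v = subst (Reach B r) s↦v (reach-map (collapse v) (collapseArcs-hom v C C⊆D) root⇝s)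

    arc : ∀ {x y} → B′ x y ≡ true → collapse v y ≡ v ⊎ B (collapse v x) (collapse v y) ≡ true
    arc {y = y} e with y ≟ t
    ... | yes refl = inj₁ t↦v
    ... | no y≢t   = inj₂ (collapseArcs-hom v C C⊆D (removeInArcs-keeps B′ y≢t e))

    reachB : ∀ y → Reach B r y
    reachB y = reach-map-via (collapse v) r⇝v arc (reach (suc y))

    arcCount<n : arcCount B < n
    arcCount<n = let x , x→t = reach-parent (reach t) t≢root in begin-strict
      arcCount B   ≤⟨ arcCount-collapseArcs v C ⟩
      arcCount C   <⟨ arcCount-mono-< (removeInArcs-⊆ t B′) x t (removeInArcs-removes t B′ x) x→t ⟩
      arcCount B′  ≡⟨ nArcs ⟩
      n            ∎
      where open ≤-Reasoning

  collapse-outbranching : ∀ {s t} → collapse v s ≡ v → collapse v t ≡ v → t ≢ suc r →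
                          Reach (removeInArcs t B′) (suc r) s →
                          Σ (Arcs n) (λ B → IsOutbranching E r B × (leaves B′ ∸ 1 ≤ leaves B))
  collapse-outbranching {t = t} s↦v t↦v t≢root root⇝s =
    collapseArcs v (removeInArcs t B′) ,
    collapse-isOutbranching s↦v t↦v t≢root root⇝s ,
    ≤-trans (∸-monoˡ-≤ 1 (leaves-antitone (removeInArcs-⊆ t B′)))
            (leaves-collapseArcs v (removeInArcs t B′))

  -- The in-arc kept is that of the copy of v entered first; if v is the root, that is suc v.
  maxleaf-duplicate : Σ (Arcs n) (λ B → IsOutbranching E r B × (leaves B′ ∸ 1 ≤ leaves B))
  maxleaf-duplicate with v ≟ r
  ... | yes refl = collapse-outbranching {suc v} {zero} refl refl (λ ()) here
  ... | no v≢r with reach-avoiding-one (λ ()) (reach (suc v))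
  ...   | inj₁ root⇝v  = collapse-outbranching {suc v} {zero} refl refl (λ ()) root⇝v
  ...   | inj₂ root⇝v′ =
    collapse-outbranching {zero} {suc v} refl refl (v≢r ∘ suc-injective) root⇝v′

lemma22 : ∀ {n : ℕ} (E : Arcs n) (r v : Fin n) → IsRootedDigraph E r →
    (spCount E ≤ spCount (duplicate E v))
    × (∀ (B' : Arcs (suc n)) → IsOutbranching (duplicate E v) (suc r) B' →
        Σ (Arcs n) (λ B → IsOutbranching E r B × (leaves B' ∸ 1 ≤ leaves B)))
lemma22 E r v _ = spCount-duplicate E v , λ B′ ob → maxleaf-duplicate ob
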